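{- If $B$ is a regular board in the square grid, then $x(B) = f(B)$.
   Context: Work in the square grid: cells are unit squares with integer corners, and two cells are neighbors if they share an edge. A board is a finite set $B$ of cells such that every cell of $B$ has at least one neighbor in $B$. A board $B$ is regular unless it contains two cells which have a common neighbor in the grid but have no common neighbor belonging to $B$. An X-pentomino is a set consisting of a cell together with its four neighbors. $x(B)$ denotes the smallest number of X-pentominoes (placed in the grid) whose union contains $B$; they may overlap each other and may contain cells outside $B$. A fragment is a cell $c$ together with a nonempty subset of its four neighbors (equivalently, a connected subset with at least two cells of an X-pentomino). A fragment tiling of $B$ is a partition of $B$ into fragments, each contained in $B$; $f(B)$ is the minimum number of fragments in a fragment tiling of $B$. -}

module Defs where

open import Data.Integer using (ℤ; _+_; _-_; +_)
open import Data.Product using (_×_; _,_; Σ; ∃; ∃-syntax)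
open import Data.Bool using (Bool; true; false)
open import Data.List using (List; []; _∷_; length; concatMap; filter)
open import Data.List.Membership.Propositional using (_∈_)
open import Data.List.Relation.Unary.Unique.Propositional using (Unique)
open import Data.List.Relation.Binary.Permutation.Propositional using (_↭_)
open import Data.List.Relation.Unary.Any using (Any)
open import Data.Sum using (_⊎_)
open import Data.Nat using (ℕ; _≤_)
open import Relation.Binary.PropositionalEquality using (_≡_; _≢_)

-- A cell of the square grid, identified by the integer coordinates of its lower-left corner.
Cell : Set
Cell = ℤ × ℤ

east west north south : Cell → Cell
east  (a , b) = (a + + 1 , b)
west  (a , b) = (a - + 1 , b)
north (a , b) = (a , b + + 1)
south (a , b) = (a , b - + 1)

neighbours : Cell → List Cell
neighbours c = east c ∷ west c ∷ north c ∷ south c ∷ []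

Adj : Cell → Cell → Set
Adj c d = d ∈ neighbours c

IsBoard : List Cell → Set
IsBoard B = Unique B × (∀ c → c ∈ B → ∃[ d ] (d ∈ B × Adj c d))

Regular : List Cell → Set
Regular B = ∀ c d → c ∈ B → d ∈ B → c ≢ d →
  ∃[ e ] (Adj c e × Adj d e) → ∃[ e ] (e ∈ B × Adj c e × Adj d e)

xPentomino : Cell → List Cell
xPentomino c = c ∷ neighbours c

XCover : List Cell → List Cell → Set
XCover B centres = ∀ b → b ∈ B → Any (λ c → b ∈ xPentomino c) centres

XNumber : List Cell → ℕ → Set
XNumber B n = (Σ (List Cell) λ cs → XCover B cs × length cs ≡ n)
  × (∀ cs → XCover B cs → n ≤ length cs)

-- A fragment: a centre cell together with a nonempty subset of its four
-- neighbours; the subset is given by four selection bits (E, W, N, S).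
record Fragment : Set where
  constructor fragment
  field
    centre : Cell
    selE selW selN selS : Bool

pick : Bool → Cell → List Cell → List Cell
pick true  x xs = x ∷ xs
pick false x xs = xs

fragmentCells : Fragment → List Cell
fragmentCells (fragment c e w n s) =
  c ∷ pick e (east c) (pick w (west c) (pick n (north c) (pick s (south c) [])))

NonemptyFragment : Fragment → Set
NonemptyFragment (fragment c e w n s) = (e ≡ true) ⊎ (w ≡ true) ⊎ (n ≡ true) ⊎ (s ≡ true)

-- A fragment tiling of B: a list of fragments whose cells, taken together
-- with multiplicity, are exactly the cells of B (each once). Hence the
-- fragments are pairwise disjoint, contained in B, and cover B: a partition.
FragmentTiling : List Cell → List Fragment → Set
FragmentTiling B fs =
  (∀ f → f ∈ fs → NonemptyFragment f) × (concatMap fragmentCells fs ↭ B)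

FNumber : List Cell → ℕ → Set
FNumber B n = (Σ (List Fragment) λ fs → FragmentTiling B fs × length fs ≡ n)
  × (∀ fs → FragmentTiling B fs → n ≤ length fs)

-- Any fragment tiling yields a cover by the X-pentominoes centred at its
-- fragments' centres, so x(B) ≤ f(B). Conversely, in a regular board every pentomino can be
-- replaced by one centred in B that covers at least the same cells of B; hence there is a
-- minimum cover whose centres D lie in B. Assign every cell of B to a pentomino of D
-- containing it, each centre to itself. The parts are fragments, except for lonely
-- centres, to which no other cell is assigned. A lonely centre c has a neighbour u in B,
-- and a local reassignment of c, u and possibly the centre of u removes one lonely centre
-- without creating centres. Repeating this yields a tiling by at most |D| = x(B) fragments.
module Submission where

open import Defs
open import Data.Bool using (true; false)
open import Data.Empty using (⊥; ⊥-elim)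
open import Data.Fin using (Fin; toℕ; fromℕ<)
open import Data.Fin.Properties as Finₚ using (toℕ<n; toℕ-fromℕ<)
open import Data.Integer as ℤ using (ℤ; +_)
open import Data.Integer.Properties using (+-assoc; +-identityʳ; +-0-abelianGroup)
open import Algebra.Properties.AbelianGroup +-0-abelianGroup using (∙-cancelˡ)
open import Data.List using (List; []; _∷_; _++_; length; filter; map; concatMap)
open import Data.List.Properties using (filter-accept; length-filter; length-map)
open import Data.List.Membership.Propositional using (_∈_; _∉_; find; lose)
open import Data.List.Membership.Propositional.Properties
  using (∈-∃++; ∈-map⁺; ∈-map⁻; ∈-filter⁺; ∈-filter⁻; ∈-concatMap⁺; ∈-concatMap⁻)
open import Data.List.Membership.Propositional.Properties.WithK using (unique∧set⇒bag)
open import Data.List.Relation.Binary.BagAndSetEquality using (∼bag⇒↭)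
open import Data.List.Relation.Binary.Disjoint.Propositional using (Disjoint)
open import Data.List.Relation.Binary.Permutation.Propositional using (↭-sym)
open import Data.List.Relation.Binary.Permutation.Propositional.Properties using (shift; ∈-resp-↭; ↭-length)
open import Data.List.Relation.Binary.Subset.Propositional using (_⊆_)
open import Data.List.Relation.Binary.Subset.Propositional.Properties using (∷⁺ʳ)
open import Data.List.Relation.Unary.All as All using (All; []; _∷_)
import Data.List.Relation.Unary.All.Properties as Allₚ
open import Data.List.Relation.Unary.AllPairs as AllPairs using (AllPairs; []; _∷_)
import Data.List.Relation.Unary.AllPairs.Properties as AllPairsₚ
open import Data.List.Relation.Unary.Any as Any using (Any; here; there; any?)
import Data.List.Relation.Unary.Any.Properties as Anyₚ
open import Data.List.Relation.Unary.Unique.Propositional using (Unique)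
import Data.List.Relation.Unary.Unique.Propositional.Properties as Uniqueₚ
open import Data.Nat using (ℕ; zero; suc; _≤_; _<_; z≤n; s≤s)
open import Data.Nat.Induction using (<-rec; <-wellFounded)
open import Data.Nat.Properties using (≤-refl; ≤-trans; ≤-reflexive; ≤-antisym; m≤n⇒m≤1+n; m<n⇒m<1+n; ≮⇒≥)
open import Data.Product using (_×_; _,_; proj₁; proj₂; ∃-syntax)
open import Data.Product.Properties using (≡-dec)
open import Data.Sum using (inj₁; inj₂)
open import Function using (_∘_; id)
open import Function.Bundles using (mk⇔)
open import Induction.WellFounded using (Acc; acc)
open import Level using (Level)
open import Relation.Binary.Definitions using (DecidableEquality)
open import Relation.Binary.PropositionalEquality
open import Relation.Nullary using (¬_; Dec; yes; no; does; ¬?; _×-dec_)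
open import Relation.Nullary.Decidable
  using (True; False; toWitness; toWitnessFalse; from-yes; from-no; decidable-stable; map′)
open import Relation.Unary using (Pred; Decidable)

-- Translations of the grid

infix 4 _≟_
_≟_ : DecidableEquality Cell
_≟_ = ≡-dec ℤ._≟_ ℤ._≟_

open import Data.List.Membership.DecPropositional _≟_ using (_∈?_)
open import Data.List.Relation.Unary.Unique.DecPropositional _≟_ using (unique?)

origin : Cell
origin = + 0 , + 0

infixl 6 _⊕_
_⊕_ : Cell → Cell → Cell
(a , b) ⊕ (i , j) = a ℤ.+ i , b ℤ.+ j

⊕-identityʳ : ∀ c → c ⊕ origin ≡ c
⊕-identityʳ (a , b) = cong₂ _,_ (+-identityʳ a) (+-identityʳ b)

⊕-cancelˡ : ∀ c {v w} → c ⊕ v ≡ c ⊕ w → v ≡ w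
⊕-cancelˡ (a , b) eq = cong₂ _,_ (∙-cancelˡ a _ _ (cong proj₁ eq)) (∙-cancelˡ b _ _ (cong proj₂ eq))

neighbours-⊕ : ∀ c v → neighbours (c ⊕ v) ≡ map (c ⊕_) (neighbours v)
neighbours-⊕ (a , b) (i , j) = cong₂ _∷_ (along₁ (+ 1)) (cong₂ _∷_ (along₁ (ℤ.- + 1))
  (cong₂ _∷_ (along₂ (+ 1)) (cong₂ _∷_ (along₂ (ℤ.- + 1)) refl)))
  where
  along₁ : ∀ k → (a ℤ.+ i ℤ.+ k , b ℤ.+ j) ≡ (a ℤ.+ (i ℤ.+ k) , b ℤ.+ j)
  along₁ k = cong (_, b ℤ.+ j) (+-assoc a i k)
  along₂ : ∀ k → (a ℤ.+ i , b ℤ.+ j ℤ.+ k) ≡ (a ℤ.+ i , b ℤ.+ (j ℤ.+ k))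
  along₂ k = cong (a ℤ.+ i ,_) (+-assoc b j k)

xPentomino-⊕ : ∀ c v → xPentomino (c ⊕ v) ≡ map (c ⊕_) (xPentomino v)
xPentomino-⊕ c v = cong (c ⊕ v ∷_) (neighbours-⊕ c v)

Adj-⊕⁺ : ∀ c {v w} → Adj v w → Adj (c ⊕ v) (c ⊕ w)
Adj-⊕⁺ c {v} {w} h = subst (c ⊕ w ∈_) (sym (neighbours-⊕ c v)) (∈-map⁺ (c ⊕_) h)

Adj-⊕⁻ : ∀ c {v x} → Adj (c ⊕ v) x → ∃[ w ] (Adj v w × x ≡ c ⊕ w)
Adj-⊕⁻ c {v} {x} h = ∈-map⁻ (c ⊕_) (subst (x ∈_) (neighbours-⊕ c v) h)

∈-xPentomino-⊕⁺ : ∀ c {v w} → w ∈ xPentomino v → c ⊕ w ∈ xPentomino (c ⊕ v)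
∈-xPentomino-⊕⁺ c {v} {w} h = subst (c ⊕ w ∈_) (sym (xPentomino-⊕ c v)) (∈-map⁺ (c ⊕_) h)

Adj⇒arm : ∀ {c x} → Adj c x → ∃[ u ] (Adj origin u × x ≡ c ⊕ u)
Adj⇒arm {c} h = Adj-⊕⁻ c (subst (λ z → Adj z _) (sym (⊕-identityʳ c)) h)

commonNeighbours : Cell → Cell → List Cell
commonNeighbours v w = filter (_∈? neighbours w) (neighbours v)

common-neighbour-⊕ : ∀ c {v w x} → Adj (c ⊕ v) x → Adj (c ⊕ w) x →
                     Any (λ u → x ≡ c ⊕ u) (commonNeighbours v w)
common-neighbour-⊕ c {w = w} hv hw with Adj-⊕⁻ c hv | Adj-⊕⁻ c hw
... | u , vu , refl | u′ , wu′ , eq rewrite ⊕-cancelˡ c eq =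
  lose (∈-filter⁺ (_∈? neighbours w) vu wu′) refl

Adj-sym : ∀ {c x} → Adj c x → Adj x c
Adj-sym {c} h with Adj⇒arm h
... | u , u∈ , refl = subst (Adj (c ⊕ u)) (⊕-identityʳ c) (Adj-⊕⁺ c (arm-back u∈))
  where
  arm-back : ∀ {u} → Adj origin u → Adj u origin
  arm-back (here refl) = there (here refl)
  arm-back (there (here refl)) = here refl
  arm-back (there (there (here refl))) = there (there (there (here refl)))
  arm-back (there (there (there (here refl)))) = there (there (here refl))

Adj-irrefl : ∀ {c} → ¬ Adj c c
Adj-irrefl {c} h with Adj⇒arm h
... | u , u∈ , eq = from-no (origin ∈? neighbours origin)
  (subst (Adj origin) (sym (⊕-cancelˡ c (trans (⊕-identityʳ c) eq))) u∈)

xPentomino-unique : ∀ c → Unique (xPentomino c)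
xPentomino-unique c = subst Unique (trans (sym (xPentomino-⊕ c origin)) (cong xPentomino (⊕-identityʳ c)))
  (Uniqueₚ.map⁺ (⊕-cancelˡ c) (from-yes (unique? (xPentomino origin))))

east₀ west₀ north₀ south₀ : Cell
east₀ = east origin
west₀ = west origin
north₀ = north origin
south₀ = south origin

-- Recentring pentominoes in regular boards

Absorbs : List Cell → Cell → Cell → Set
Absorbs B d c = ∀ b → b ∈ B → b ∈ xPentomino c → d ∈ B × b ∈ xPentomino d

module _ {B : List Cell} (regular : Regular B) {c : Cell} (c∉B : c ∉ B) where

  arms-meet : ∀ u v → c ⊕ u ∈ B → c ⊕ v ∈ B →
              {_ : False (u ≟ v)} {_ : True (u ∈? neighbours origin)} {_ : True (v ∈? neighbours origin)} →
              Any (λ w → c ⊕ w ∈ B) (commonNeighbours u v)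
  arms-meet u v uB vB {u≢v} {u∈} {v∈}
    with regular _ _ uB vB (toWitnessFalse u≢v ∘ ⊕-cancelˡ c)
                  (c ⊕ origin , Adj-⊕⁺ c (Adj-sym (toWitness u∈)) , Adj-⊕⁺ c (Adj-sym (toWitness v∈)))
  ... | e , eB , ue , ve = Any.map (λ eq → subst (_∈ B) eq eB) (common-neighbour-⊕ c ue ve)

  beside-origin : ∀ {ws} → Any (λ w → c ⊕ w ∈ B) (origin ∷ ws) → Any (λ w → c ⊕ w ∈ B) ws
  beside-origin (here p) = ⊥-elim (c∉B (subst (_∈ B) (⊕-identityʳ c) p))
  beside-origin (there p) = p

  opposite : Any (λ w → c ⊕ w ∈ B) (origin ∷ []) → ⊥
  opposite p with beside-origin p
  ... | ()

  diagonal : ∀ {w} → Any (λ w → c ⊕ w ∈ B) (origin ∷ w ∷ []) → c ⊕ w ∈ B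
  diagonal p with beside-origin p
  ... | here q = q

  absorbs-by-arms : ∀ {d} → All (λ u → c ⊕ u ∈ B → d ∈ B × c ⊕ u ∈ xPentomino d) (neighbours origin) →
                    Absorbs B d c
  absorbs-by-arms arms b bB (here refl) = ⊥-elim (c∉B bB)
  absorbs-by-arms arms b bB (there adj) with Adj⇒arm adj
  ... | u , u∈ , refl = All.lookup arms u∈ bB

  toward : ∀ {u v} → c ⊕ v ∈ B → {_ : True (u ∈? xPentomino v)} →
           c ⊕ u ∈ B → c ⊕ v ∈ B × c ⊕ u ∈ xPentomino (c ⊕ v)
  toward vB {u∈} _ = vB , ∈-xPentomino-⊕⁺ c (toWitness u∈)

  absent : ∀ {u} {A : Set} → c ⊕ u ∉ B → c ⊕ u ∈ B → A
  absent u∉B uB = ⊥-elim (u∉B uB)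

  -- Two opposite arms of c cannot both lie in B, since their only common neighbour is c;
  -- two perpendicular arms in B force the diagonal cell between them into B.
  missing-centre-absorbed : ∃[ d ] Absorbs B d c
  missing-centre-absorbed with c ⊕ east₀ ∈? B | c ⊕ west₀ ∈? B | c ⊕ north₀ ∈? B | c ⊕ south₀ ∈? B
  ... | yes e | yes w | _     | _     = ⊥-elim (opposite (arms-meet east₀ west₀ e w))
  ... | _     | _     | yes n | yes s = ⊥-elim (opposite (arms-meet north₀ south₀ n s))
  ... | yes e | no w  | yes n | no s  = let dB = diagonal (arms-meet east₀ north₀ e n) in
    c ⊕ north east₀ , absorbs-by-arms (toward dB ∷ absent w ∷ toward dB ∷ absent s ∷ [])
  ... | yes e | no w  | no n  | yes s = let dB = diagonal (arms-meet east₀ south₀ e s) in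
    c ⊕ south east₀ , absorbs-by-arms (toward dB ∷ absent w ∷ absent n ∷ toward dB ∷ [])
  ... | no e  | yes w | yes n | no s  = let dB = diagonal (arms-meet west₀ north₀ w n) in
    c ⊕ north west₀ , absorbs-by-arms (absent e ∷ toward dB ∷ toward dB ∷ absent s ∷ [])
  ... | no e  | yes w | no n  | yes s = let dB = diagonal (arms-meet west₀ south₀ w s) in
    c ⊕ south west₀ , absorbs-by-arms (absent e ∷ toward dB ∷ absent n ∷ toward dB ∷ [])
  ... | yes e | no w  | no n  | no s  =
    c ⊕ east₀ , absorbs-by-arms (toward e ∷ absent w ∷ absent n ∷ absent s ∷ [])
  ... | no e  | yes w | no n  | no s  =
    c ⊕ west₀ , absorbs-by-arms (absent e ∷ toward w ∷ absent n ∷ absent s ∷ [])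
  ... | no e  | no w  | yes n | no s  =
    c ⊕ north₀ , absorbs-by-arms (absent e ∷ absent w ∷ toward n ∷ absent s ∷ [])
  ... | no e  | no w  | no n  | yes s =
    c ⊕ south₀ , absorbs-by-arms (absent e ∷ absent w ∷ absent n ∷ toward s ∷ [])
  ... | no e  | no w  | no n  | no s  =
    c , absorbs-by-arms (absent e ∷ absent w ∷ absent n ∷ absent s ∷ [])

regular⇒absorbed : ∀ {B} → Regular B → ∀ c → ∃[ d ] Absorbs B d c
regular⇒absorbed {B} regular c with c ∈? B
... | yes c∈B = c , λ _ _ bc → c∈B , bc
... | no c∉B = missing-centre-absorbed regular c∉B

private variable
  a p q : Level
  A : Set a

module _ {P : Pred A p} {Q : Pred A q} (P? : Decidable P) (Q? : Decidable Q) where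

  length-filter-mono : ∀ xs → (∀ {x} → x ∈ xs → P x → Q x) →
                       length (filter P? xs) ≤ length (filter Q? xs)
  length-filter-mono [] _ = z≤n
  length-filter-mono (x ∷ xs) P⇒Q with P? x | Q? x
  ... | yes px | yes _  = s≤s (length-filter-mono xs (P⇒Q ∘ there))
  ... | yes px | no ¬qx = ⊥-elim (¬qx (P⇒Q (here refl) px))
  ... | no _   | yes _  = m≤n⇒m≤1+n (length-filter-mono xs (P⇒Q ∘ there))
  ... | no _   | no _   = length-filter-mono xs (P⇒Q ∘ there)

  length-filter-mono-< : ∀ xs → (∀ {x} → x ∈ xs → P x → Q x) → Any (λ x → Q x × ¬ P x) xs →
                         length (filter P? xs) < length (filter Q? xs)
  length-filter-mono-< (x ∷ xs) P⇒Q (here (qx , ¬px)) with P? x | Q? x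
  ... | yes px | _      = ⊥-elim (¬px px)
  ... | no _   | yes _  = s≤s (length-filter-mono xs (P⇒Q ∘ there))
  ... | no _   | no ¬qx = ⊥-elim (¬qx qx)
  length-filter-mono-< (x ∷ xs) P⇒Q (there w) with P? x | Q? x
  ... | yes _  | yes _  = s≤s (length-filter-mono-< xs (P⇒Q ∘ there) w)
  ... | yes px | no ¬qx = ⊥-elim (¬qx (P⇒Q (here refl) px))
  ... | no _   | yes _  = m<n⇒m<1+n (length-filter-mono-< xs (P⇒Q ∘ there) w)
  ... | no _   | no _   = length-filter-mono-< xs (P⇒Q ∘ there) w

  length-filter-≤-suc : ∀ {u} xs → Unique xs → (∀ {x} → x ∈ xs → x ≢ u → P x → Q x) →
                        length (filter P? xs) ≤ suc (length (filter Q? xs))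
  length-filter-≤-suc [] _ _ = z≤n
  length-filter-≤-suc {u} (x ∷ xs) (x∉ ∷ uniq) P⇒Q with P? x | Q? x
  ... | yes _  | yes _  = s≤s (length-filter-≤-suc xs uniq (P⇒Q ∘ there))
  ... | yes px | no ¬qx = s≤s (length-filter-mono xs P⇒Q′)
    where
    x≡u : ¬ x ≢ u
    x≡u x≢u = ¬qx (P⇒Q (here refl) x≢u px)
    P⇒Q′ : ∀ {y} → y ∈ xs → P y → Q y
    P⇒Q′ {y} y∈ = P⇒Q (there y∈) λ { refl → x≡u λ { refl →
      Uniqueₚ.Unique[x∷xs]⇒x∉xs (x∉ ∷ uniq) y∈ } }
  ... | no _   | yes _  = m≤n⇒m≤1+n (length-filter-≤-suc xs uniq (P⇒Q ∘ there))
  ... | no _   | no _   = length-filter-≤-suc xs uniq (P⇒Q ∘ there)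

Unique-⊆⇒length≤ : ∀ {xs ys : List A} → Unique xs → xs ⊆ ys → length xs ≤ length ys
Unique-⊆⇒length≤ {xs = []} _ _ = z≤n
Unique-⊆⇒length≤ {xs = x ∷ xs} uniq@(_ ∷ uniq′) x∷xs⊆ys with ∈-∃++ (x∷xs⊆ys (here refl))
... | l , r , refl = subst (suc (length xs) ≤_) (sym (↭-length (shift x l r)))
                           (s≤s (Unique-⊆⇒length≤ uniq′ xs⊆l++r))
  where
  xs⊆l++r : xs ⊆ l ++ r
  xs⊆l++r y∈ with ∈-resp-↭ (shift x l r) (x∷xs⊆ys (there y∈))
  ... | here refl = ⊥-elim (Uniqueₚ.Unique[x∷xs]⇒x∉xs uniq y∈)
  ... | there y∈′ = y∈′

tuples : ℕ → List A → List (List A)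
tuples zero    xs = [] ∷ []
tuples (suc k) xs = concatMap (λ x → map (x ∷_) (tuples k xs)) xs

∈-tuples⁺ : ∀ {xs : List A} zs → zs ⊆ xs → zs ∈ tuples (length zs) xs
∈-tuples⁺ []       _   = here refl
∈-tuples⁺ (z ∷ zs) sub =
  ∈-concatMap⁺ _ (Any.map (λ { refl → ∈-map⁺ (z ∷_) (∈-tuples⁺ zs (sub ∘ there)) }) (sub (here refl)))

∈-tuples⁻ : ∀ k {xs zs : List A} → zs ∈ tuples k xs → zs ⊆ xs × length zs ≡ k
∈-tuples⁻ zero    (here refl) = (λ ()) , refl
∈-tuples⁻ (suc k) {xs} zs∈ with find (∈-concatMap⁻ (λ x → map (x ∷_) (tuples k xs)) {xs = xs} zs∈)
... | x , x∈xs , ∈map with ∈-map⁻ (x ∷_) ∈map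
...   | ys , ys∈ , refl with ∈-tuples⁻ k ys∈
...     | ys⊆xs , ys-length = (λ { (here refl) → x∈xs ; (there y∈) → ys⊆xs y∈ }) , cong suc ys-length

least-witness : ∀ {P : Pred ℕ p} → Decidable P → ∀ {n} → P n → ∃[ m ] (P m × (∀ {k} → P k → m ≤ k))
least-witness {P = P} P? {n} = <-rec (λ n → P n → ∃[ m ] (P m × (∀ {k} → P k → m ≤ k))) search n
  where
  search : ∀ n → (∀ {j} → j < n → P j → ∃[ m ] (P m × (∀ {k} → P k → m ≤ k))) →
           P n → ∃[ m ] (P m × (∀ {k} → P k → m ≤ k))
  search n smaller pn with Finₚ.any? (λ (j : Fin n) → P? (toℕ j))
  ... | yes (j , pj) = smaller (toℕ<n j) pj
  ... | no none      = n , pn , λ {k} pk → ≮⇒≥ λ k<n → none (fromℕ< k<n , subst P (sym (toℕ-fromℕ< k<n)) pk)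

AllPairs-with-All : ∀ {r} {P : Pred A p} {R : A → A → Set r} {xs} → All P xs → AllPairs R xs →
                    AllPairs (λ x y → P x × P y × R x y) xs
AllPairs-with-All [] [] = []
AllPairs-with-All (px ∷ pxs) (rx ∷ rxs) = All.zipWith (λ (py , r) → px , py , r) (pxs , rx) ∷ AllPairs-with-All pxs rxs

pick-filter : ∀ {ℓ} {P : Pred Cell ℓ} (P? : Decidable P) x xs →
              pick (does (P? x)) x (filter P? xs) ≡ filter P? (x ∷ xs)
pick-filter P? x xs with P? x
... | yes _ = refl
... | no _  = refl

fragmentBy : ∀ {ℓ} {P : Pred Cell ℓ} → Decidable P → Cell → Fragment
fragmentBy P? c = fragment c (does (P? (east c))) (does (P? (west c))) (does (P? (north c))) (does (P? (south c)))

fragmentBy-cells : ∀ {ℓ} {P : Pred Cell ℓ} (P? : Decidable P) c →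
                   fragmentCells (fragmentBy P? c) ≡ c ∷ filter P? (neighbours c)
fragmentBy-cells P? c
  rewrite pick-filter P? (south c) []
        | pick-filter P? (north c) (south c ∷ [])
        | pick-filter P? (west c) (north c ∷ south c ∷ [])
        | pick-filter P? (east c) (west c ∷ north c ∷ south c ∷ []) = refl

pick-⊆ : ∀ b x {xs ys} → xs ⊆ ys → pick b x xs ⊆ x ∷ ys
pick-⊆ true  x xs⊆ys = ∷⁺ʳ x xs⊆ys
pick-⊆ false x xs⊆ys = there ∘ xs⊆ys

fragment⊆xPentomino : ∀ f → fragmentCells f ⊆ xPentomino (Fragment.centre f)
fragment⊆xPentomino (fragment c e w n s) =
  ∷⁺ʳ c (pick-⊆ e _ (pick-⊆ w _ (pick-⊆ n _ (pick-⊆ s _ λ ()))))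

arm⇒NonemptyFragment : ∀ f {x} → x ∈ fragmentCells f → x ≢ Fragment.centre f → NonemptyFragment f
arm⇒NonemptyFragment (fragment c true  _     _     _)     _ _ = inj₁ refl
arm⇒NonemptyFragment (fragment c false true  _     _)     _ _ = inj₂ (inj₁ refl)
arm⇒NonemptyFragment (fragment c false false true  _)     _ _ = inj₂ (inj₂ (inj₁ refl))
arm⇒NonemptyFragment (fragment c false false false true)  _ _ = inj₂ (inj₂ (inj₂ refl))
arm⇒NonemptyFragment (fragment c false false false false) (here x≡c) x≢c = ⊥-elim (x≢c x≡c)

tiling⇒cover : ∀ {B fs} → FragmentTiling B fs → XCover B (map Fragment.centre fs)
tiling⇒cover {fs = fs} (_ , fs↭B) b b∈B
  with find (∈-concatMap⁻ fragmentCells {xs = fs} (∈-resp-↭ (↭-sym fs↭B) b∈B))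
... | f , f∈fs , b∈f = Anyₚ.map⁺ (lose f∈fs (fragment⊆xPentomino f b∈f))

-- Assignments of cells to centres

infixl 9 _[_↦_]
-- Opaque so that unfolding does not interfere with later case splits on _≟_.
opaque
  _[_↦_] : (Cell → Cell) → Cell → Cell → Cell → Cell
  (o [ a ↦ v ]) x with x ≟ a
  ... | yes _ = v
  ... | no _  = o x

  [↦]-same : ∀ o a v → (o [ a ↦ v ]) a ≡ v
  [↦]-same o a v with a ≟ a
  ... | yes _  = refl
  ... | no a≢a = ⊥-elim (a≢a refl)

  [↦]-other : ∀ o {a} v {x} → x ≢ a → (o [ a ↦ v ]) x ≡ o x
  [↦]-other o {a} v {x} x≢a with x ≟ a
  ... | yes x≡a = ⊥-elim (x≢a x≡a)
  ... | no _    = refl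

module Assignments (B : List Cell) (B-unique : Unique B) (board : ∀ c → c ∈ B → ∃[ d ] (d ∈ B × Adj c d)) where

  -- o sends each cell of B to the centre of its part; the centres are the fixed points of o.
  IsAssignment : (Cell → Cell) → Set
  IsAssignment o = ∀ {b} → b ∈ B → o b ∈ B × o (o b) ≡ o b × b ∈ xPentomino (o b)

  centres : (Cell → Cell) → List Cell
  centres o = filter (λ x → o x ≟ x) B

  Leaf : (Cell → Cell) → Cell → Cell → Set
  Leaf o c b = b ≢ c × o b ≡ c

  HasLeaf : (Cell → Cell) → Cell → Set
  HasLeaf o c = Any (Leaf o c) B

  Lonely : (Cell → Cell) → Cell → Set
  Lonely o c = o c ≡ c × ¬ HasLeaf o c

  hasLeaf? : ∀ o c → Dec (HasLeaf o c)
  hasLeaf? o c = any? (λ b → ¬? (b ≟ c) ×-dec (o b ≟ c)) B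

  lonely? : ∀ o c → Dec (Lonely o c)
  lonely? o c = (o c ≟ c) ×-dec ¬? (hasLeaf? o c)

  lonelyCentres : (Cell → Cell) → List Cell
  lonelyCentres o = filter (lonely? o) B

  record Improvement (o : Cell → Cell) : Set where
    field
      assignment    : Cell → Cell
      isAssignment  : IsAssignment assignment
      fewer-lonely  : length (lonelyCentres assignment) < length (lonelyCentres o)
      no-more-centres : length (centres assignment) ≤ length (centres o)

  assigned-to : ∀ (o : Cell → Cell) b v → o b ≡ v → v ∈ B → o v ≡ v → b ∈ xPentomino v →
                o b ∈ B × o (o b) ≡ o b × b ∈ xPentomino (o b)
  assigned-to o b v p v∈B ov b∈X rewrite p = v∈B , ov , b∈X

  HasLeaf-map : ∀ {o o′ c} → (∀ {b} → b ∈ B → Leaf o c b → HasLeaf o′ c) → HasLeaf o c → HasLeaf o′ c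
  HasLeaf-map f h with find h
  ... | b , b∈B , leaf = f b∈B leaf

  module Repair {o} (assigned : IsAssignment o) {c} (c∈B : c ∈ B) (c-lonely : Lonely o c)
                {u} (u∈B : u ∈ B) (c-u : Adj c u) where

    oc : o c ≡ c
    oc = proj₁ c-lonely

    u≢c : u ≢ c
    u≢c refl = Adj-irrefl c-u

    not-owned-by-c : ∀ {b} → b ∈ B → b ≢ c → o b ≢ c
    not-owned-by-c b∈B b≢c ob≡c = proj₂ c-lonely (lose b∈B (b≢c , ob≡c))

    unchanged : ∀ (o′ : Cell → Cell) {b} → b ∈ B → o′ b ≡ o b → o′ (o b) ≡ o (o b) →
                o′ b ∈ B × o′ (o′ b) ≡ o′ b × b ∈ xPentomino (o′ b)
    unchanged o′ {b} b∈B p q with assigned b∈B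
    ... | ob∈B , oob , b∈X = assigned-to o′ b _ p ob∈B (trans q oob) b∈X

    fewer-lonely-than : ∀ {o′} → ¬ Lonely o′ c → (∀ {x} → x ∈ B → x ≢ c → Lonely o′ x → Lonely o x) →
                        length (lonelyCentres o′) < length (lonelyCentres o)
    fewer-lonely-than ¬lonely-c was-lonely =
      length-filter-mono-< _ _ B back (lose c∈B (c-lonely , ¬lonely-c))
      where
      back : ∀ {x} → x ∈ B → _ → _
      back {x} x∈B l with x ≟ c
      ... | yes refl = ⊥-elim (¬lonely-c l)
      ... | no x≢c   = was-lonely x∈B x≢c l

    join-centre : o u ≡ u → Improvement o
    join-centre ou = record
      { assignment    = o′
      ; isAssignment  = assigned′
      ; fewer-lonely  = fewer-lonely-than (λ (o′c , _) → u≢c (trans (sym (o′-c)) o′c)) was-lonely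
      ; no-more-centres = length-filter-mono _ _ B was-centre
      }
      where
      o′ = o [ c ↦ u ]
      o′-c : o′ c ≡ u
      o′-c = [↦]-same o c u
      o′-else : ∀ {x} → x ≢ c → o′ x ≡ o x
      o′-else = [↦]-other o u
      assigned′ : IsAssignment o′
      assigned′ {b} b∈B with b ≟ c
      ... | yes refl = assigned-to o′ c u o′-c u∈B (trans (o′-else u≢c) ou) (there (Adj-sym c-u))
      ... | no b≢c   = unchanged o′ b∈B (o′-else b≢c) (o′-else (not-owned-by-c b∈B b≢c))
      was-centre : ∀ {x} → x ∈ B → o′ x ≡ x → o x ≡ x
      was-centre {x} _ o′x with x ≟ c
      ... | yes refl = ⊥-elim (u≢c (trans (sym o′-c) o′x))
      ... | no x≢c   = trans (sym (o′-else x≢c)) o′x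
      was-lonely : ∀ {x} → x ∈ B → x ≢ c → Lonely o′ x → Lonely o x
      was-lonely {x} x∈B x≢c (o′x , no-leaf) = was-centre x∈B o′x , no-leaf ∘ HasLeaf-map keep
        where
        keep : ∀ {b} → b ∈ B → Leaf o x b → HasLeaf o′ x
        keep b∈B (b≢x , ob) = lose b∈B (b≢x , trans (o′-else λ { refl → x≢c (trans (sym ob) oc) }) ob)

    module _ (ou≢u : o u ≢ u) where

      d : Cell
      d = o u

      od : o d ≡ d
      od = proj₁ (proj₂ (assigned u∈B))

      d-u : Adj d u
      d-u with proj₂ (proj₂ (assigned u∈B))
      ... | here u≡d  = ⊥-elim (ou≢u (sym u≡d))
      ... | there adj = adj

      not-owned-by-u : ∀ {b} → b ∈ B → o b ≢ u
      not-owned-by-u b∈B ob≡u = ou≢u (trans (cong o (sym ob≡u)) (trans (proj₁ (proj₂ (assigned b∈B))) ob≡u))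

      -- Moving u into c's part is harmless because d keeps its other leaf w.
      take-leaf : Any (λ w → w ≢ u × Leaf o d w) B → Improvement o
      take-leaf other = record
        { assignment    = o′
        ; isAssignment  = assigned′
        ; fewer-lonely  = fewer-lonely-than (λ (_ , no-leaf) → no-leaf (lose u∈B (u≢c , o′-u))) was-lonely
        ; no-more-centres = length-filter-mono _ _ B was-centre
        }
        where
        o′ = o [ u ↦ c ]
        o′-u : o′ u ≡ c
        o′-u = [↦]-same o u c
        o′-else : ∀ {x} → x ≢ u → o′ x ≡ o x
        o′-else = [↦]-other o c
        assigned′ : IsAssignment o′
        assigned′ {b} b∈B with b ≟ u
        ... | yes refl = assigned-to o′ u c o′-u c∈B (trans (o′-else (u≢c ∘ sym)) oc) (there c-u)
        ... | no b≢u   = unchanged o′ b∈B (o′-else b≢u) (o′-else (not-owned-by-u b∈B))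
        was-centre : ∀ {x} → x ∈ B → o′ x ≡ x → o x ≡ x
        was-centre {x} _ o′x with x ≟ u
        ... | yes refl = ⊥-elim (u≢c (sym (trans (sym o′-u) o′x)))
        ... | no x≢u   = trans (sym (o′-else x≢u)) o′x
        was-lonely : ∀ {x} → x ∈ B → x ≢ c → Lonely o′ x → Lonely o x
        was-lonely {x} x∈B x≢c (o′x , no-leaf) = was-centre x∈B o′x , no-leaf ∘ HasLeaf-map keep
          where
          keep : ∀ {b} → b ∈ B → Leaf o x b → HasLeaf o′ x
          keep {b} b∈B (b≢x , ob) with b ≟ u
          ... | yes refl = Any.map (λ (w≢u , w≢d , ow) → (λ w≡x → w≢d (trans w≡x (sym ob))) ,
                                                        trans (o′-else w≢u) (trans ow ob)) other
          ... | no b≢u   = lose b∈B (b≢x , trans (o′-else b≢u) ob)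

      -- d would become lonely if u left it, so u becomes the centre of c, u and d instead.
      merge : ¬ Any (λ w → w ≢ u × Leaf o d w) B → Improvement o
      merge alone = record
        { assignment    = o′
        ; isAssignment  = assigned′
        ; fewer-lonely  = fewer-lonely-than (λ (o′c , _) → u≢c (trans (sym o′-c) o′c)) was-lonely
        ; no-more-centres = no-more-centres
        }
        where
        d≢u : d ≢ u
        d≢u = ou≢u
        d≢c : d ≢ c
        d≢c = not-owned-by-c u∈B u≢c
        o₁ = o [ d ↦ u ] [ c ↦ u ]
        o′ = o₁ [ u ↦ u ]
        o′≗o₁ : ∀ {x} → x ≢ u → o′ x ≡ o₁ x
        o′≗o₁ = [↦]-other o₁ u
        o₁-c : o₁ c ≡ u
        o₁-c = [↦]-same _ c u
        o₁-d : o₁ d ≡ u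
        o₁-d = trans ([↦]-other _ u d≢c) ([↦]-same o d u)
        o₁-else : ∀ {x} → x ≢ c → x ≢ d → o₁ x ≡ o x
        o₁-else x≢c x≢d = trans ([↦]-other _ u x≢c) ([↦]-other o u x≢d)
        o′-u : o′ u ≡ u
        o′-u = [↦]-same o₁ u u
        o′-c : o′ c ≡ u
        o′-c = trans (o′≗o₁ (u≢c ∘ sym)) o₁-c
        o′-d : o′ d ≡ u
        o′-d = trans (o′≗o₁ d≢u) o₁-d
        o′-else : ∀ {x} → x ≢ u → x ≢ c → x ≢ d → o′ x ≡ o x
        o′-else x≢u x≢c x≢d = trans (o′≗o₁ x≢u) (o₁-else x≢c x≢d)
        assigned′ : IsAssignment o′
        assigned′ {b} b∈B with b ≟ u | b ≟ c | b ≟ d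
        ... | yes refl | _        | _        = assigned-to o′ u u o′-u u∈B o′-u (here refl)
        ... | no _     | yes refl | _        = assigned-to o′ c u o′-c u∈B o′-u (there (Adj-sym c-u))
        ... | no _     | no _     | yes refl = assigned-to o′ d u o′-d u∈B o′-u (there (Adj-sym d-u))
        ... | no b≢u   | no b≢c   | no b≢d   =
          unchanged o′ b∈B (o′-else b≢u b≢c b≢d)
                    (o′-else (not-owned-by-u b∈B) (not-owned-by-c b∈B b≢c)
                             λ ob≡d → alone (lose b∈B (b≢u , b≢d , ob≡d)))
        was-centre₁ : ∀ {x} → x ∈ B → o₁ x ≡ x → o x ≡ x
        was-centre₁ {x} _ o₁x with x ≟ c | x ≟ d
        ... | yes refl | _        = ⊥-elim (u≢c (trans (sym o₁-c) o₁x))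
        ... | no _     | yes refl = ⊥-elim (d≢u (sym (trans (sym o₁-d) o₁x)))
        ... | no x≢c   | no x≢d   = trans (sym (o₁-else x≢c x≢d)) o₁x
        -- o₁ loses the centre c, and o′ adds only u.
        no-more-centres : length (centres o′) ≤ length (centres o)
        no-more-centres =
          ≤-trans (length-filter-≤-suc _ (λ x → o₁ x ≟ x) {u = u} B B-unique
                                       λ _ x≢u o′x → trans (sym (o′≗o₁ x≢u)) o′x)
                  (length-filter-mono-< _ _ B was-centre₁ (lose c∈B (oc , λ o₁c → u≢c (trans (sym o₁-c) o₁c))))
        was-lonely : ∀ {x} → x ∈ B → x ≢ c → Lonely o′ x → Lonely o x
        was-lonely {x} x∈B x≢c (o′x , no-leaf) with x ≟ u | x ≟ d
        ... | yes refl | _        = ⊥-elim (no-leaf (lose c∈B ((u≢c ∘ sym) , o′-c)))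
        ... | no _     | yes refl = ⊥-elim (d≢u (sym (trans (sym o′-d) o′x)))
        ... | no x≢u   | no x≢d   = ox , no-leaf ∘ HasLeaf-map keep
          where
          ox : o x ≡ x
          ox = trans (sym (o′-else x≢u x≢c x≢d)) o′x
          keep : ∀ {b} → b ∈ B → Leaf o x b → HasLeaf o′ x
          keep {b} b∈B (b≢x , ob) = lose b∈B (b≢x , trans (o′-else b≢u b≢c b≢d) ob)
            where
            b≢u : b ≢ u
            b≢u b≡u = x≢d (trans (sym ob) (cong o b≡u))
            b≢c : b ≢ c
            b≢c b≡c = x≢c (trans (sym ob) (trans (cong o b≡c) oc))
            b≢d : b ≢ d
            b≢d b≡d = x≢d (trans (sym ob) (trans (cong o b≡d) od))

    improvement : Improvement o
    improvement with o u ≟ u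
    ... | yes ou = join-centre ou
    ... | no ou≢u with any? (λ w → ¬? (w ≟ u) ×-dec (¬? (w ≟ o u) ×-dec (o w ≟ o u))) B
    ...   | yes other = take-leaf ou≢u other
    ...   | no alone  = merge ou≢u alone

  NoLonelyCentre : (Cell → Cell) → Set
  NoLonelyCentre o = ∀ {c} → c ∈ B → o c ≡ c → HasLeaf o c

  without-lonely-centres : ∀ {o} → IsAssignment o →
    ∃[ o′ ] (IsAssignment o′ × NoLonelyCentre o′ × length (centres o′) ≤ length (centres o))
  without-lonely-centres {o} assigned = descend o assigned (<-wellFounded _)
    where
    descend : ∀ o → IsAssignment o → Acc _<_ (length (lonelyCentres o)) →
              ∃[ o′ ] (IsAssignment o′ × NoLonelyCentre o′ × length (centres o′) ≤ length (centres o))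
    descend o assigned (acc smaller) with any? (lonely? o) B
    ... | no none = o , assigned , no-lonely , ≤-refl
      where
      no-lonely : NoLonelyCentre o
      no-lonely c∈B oc = decidable-stable (hasLeaf? o _) λ no-leaf → none (lose c∈B (oc , no-leaf))
    ... | yes lonely with find lonely
    ...   | c , c∈B , c-lonely with board c c∈B
    ...     | u , u∈B , c-u = continue (Repair.improvement assigned c∈B c-lonely u∈B c-u)
      where
      continue : Improvement o →
                 ∃[ o′ ] (IsAssignment o′ × NoLonelyCentre o′ × length (centres o′) ≤ length (centres o))
      continue record { assignment = o₁ ; isAssignment = assigned₁ ; fewer-lonely = fewer ; no-more-centres = le }
        with descend o₁ assigned₁ (smaller fewer)
      ... | o′ , assigned′ , no-lonely , le′ = o′ , assigned′ , no-lonely , ≤-trans le′ le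

  module FromCover {D : List Cell} (D⊆B : D ⊆ B) (cover : XCover B D) where

    chosenCentre : Cell → Cell
    chosenCentre b with b ∈? D
    ... | yes _ = b
    ... | no _ with any? (λ d → b ∈? xPentomino d) D
    ...   | yes b∈X = proj₁ (find b∈X)
    ...   | no _    = b

    chosenCentre-fixed : ∀ {d} → d ∈ D → chosenCentre d ≡ d
    chosenCentre-fixed {d} d∈D with d ∈? D
    ... | yes _   = refl
    ... | no d∉D  = ⊥-elim (d∉D d∈D)

    chosenCentre-covers : ∀ {b} → b ∈ B → chosenCentre b ∈ D × b ∈ xPentomino (chosenCentre b)
    chosenCentre-covers {b} b∈B with b ∈? D
    ... | yes b∈D = b∈D , here refl
    ... | no _ with any? (λ d → b ∈? xPentomino d) D
    ...   | yes b∈X = proj₂ (find b∈X)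
    ...   | no b∉X  = ⊥-elim (b∉X (cover b b∈B))

    chosenCentre-assignment : IsAssignment chosenCentre
    chosenCentre-assignment b∈B with chosenCentre-covers b∈B
    ... | d∈D , b∈X = D⊆B d∈D , chosenCentre-fixed d∈D , b∈X

    chosenCentre-centres : length (centres chosenCentre) ≤ length D
    chosenCentre-centres = Unique-⊆⇒length≤ (Uniqueₚ.filter⁺ _ B-unique) centre∈D
      where
      centre∈D : centres chosenCentre ⊆ D
      centre∈D x∈ with ∈-filter⁻ _ x∈
      ... | x∈B , cx≡x = subst (_∈ D) cx≡x (proj₁ (chosenCentre-covers x∈B))

  module Parts {o} (assigned : IsAssignment o) (no-lonely : NoLonelyCentre o) where

    owns? : ∀ c x → Dec (x ∈ B × o x ≡ c)
    owns? c x = (x ∈? B) ×-dec (o x ≟ c)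

    part : Cell → Fragment
    part c = fragmentBy (owns? c) c

    part-cells : ∀ {c} → c ∈ B → o c ≡ c → fragmentCells (part c) ≡ filter (owns? c) (xPentomino c)
    part-cells {c} c∈B oc = trans (fragmentBy-cells (owns? c) c) (sym (filter-accept (owns? c) (c∈B , oc)))

    ∈-part⁻ : ∀ {c x} → c ∈ centres o → x ∈ fragmentCells (part c) → x ∈ B × o x ≡ c
    ∈-part⁻ c∈K x∈ with ∈-filter⁻ _ c∈K
    ... | c∈B , oc = proj₂ (∈-filter⁻ (owns? _) (subst (_ ∈_) (part-cells c∈B oc) x∈))

    ∈-part⁺ : ∀ {x} → x ∈ B → x ∈ fragmentCells (part (o x))
    ∈-part⁺ x∈B with assigned x∈B
    ... | ox∈B , oox , x∈X = subst (_ ∈_) (sym (part-cells ox∈B oox)) (∈-filter⁺ (owns? _) x∈X (x∈B , refl))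

    part-unique : ∀ {c} → c ∈ centres o → Unique (fragmentCells (part c))
    part-unique c∈K with ∈-filter⁻ _ c∈K
    ... | c∈B , oc = subst Unique (sym (part-cells c∈B oc)) (Uniqueₚ.filter⁺ (owns? _) (xPentomino-unique _))

    parts : List Fragment
    parts = map part (centres o)

    parts-cells-unique : Unique (concatMap fragmentCells parts)
    parts-cells-unique = Uniqueₚ.concat⁺ (Allₚ.map⁺ (Allₚ.map⁺ (All.tabulate part-unique)))
      (AllPairsₚ.map⁺ (AllPairsₚ.map⁺ (AllPairs.map disjoint
        (AllPairs-with-All (All.tabulate id) (Uniqueₚ.filter⁺ _ B-unique)))))
      where
      disjoint : ∀ {c c′} → c ∈ centres o × c′ ∈ centres o × c ≢ c′ →
                 Disjoint (fragmentCells (part c)) (fragmentCells (part c′))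
      disjoint (c∈K , c′∈K , c≢c′) (x∈ , x∈′) =
        c≢c′ (trans (sym (proj₂ (∈-part⁻ c∈K x∈))) (proj₂ (∈-part⁻ c′∈K x∈′)))

    parts-tiling : FragmentTiling B parts
    parts-tiling = nonempty , ∼bag⇒↭ (unique∧set⇒bag parts-cells-unique B-unique (mk⇔ to from))
      where
      nonempty : ∀ f → f ∈ parts → NonemptyFragment f
      nonempty f f∈ with ∈-map⁻ part f∈
      ... | c , c∈K , refl with ∈-filter⁻ _ c∈K
      ...   | c∈B , oc with find (no-lonely c∈B oc)
      ...     | b , b∈B , b≢c , ob =
        arm⇒NonemptyFragment (part c) (subst (λ z → b ∈ fragmentCells (part z)) ob (∈-part⁺ b∈B)) b≢c
      to : ∀ {x} → x ∈ concatMap fragmentCells parts → x ∈ B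
      to x∈ with find (Anyₚ.map⁻ (∈-concatMap⁻ fragmentCells {xs = parts} x∈))
      ... | c , c∈K , x∈part = proj₁ (∈-part⁻ c∈K x∈part)
      from : ∀ {x} → x ∈ B → x ∈ concatMap fragmentCells parts
      from x∈B with assigned x∈B
      ... | ox∈B , oox , _ =
        ∈-concatMap⁺ fragmentCells (Anyₚ.map⁺ (lose (∈-filter⁺ _ ox∈B oox) (∈-part⁺ x∈B)))

  -- Opaque: matching on the result would otherwise make the type checker unfold the repair process.
  opaque
    tiling-from-cover : ∀ {D} → D ⊆ B → XCover B D → ∃[ fs ] (FragmentTiling B fs × length fs ≤ length D)
    tiling-from-cover D⊆B cover with without-lonely-centres (FromCover.chosenCentre-assignment D⊆B cover)
    ... | o , assigned , no-lonely , le =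
      Parts.parts assigned no-lonely , Parts.parts-tiling assigned no-lonely ,
      ≤-trans (≤-reflexive (length-map _ (centres o))) (≤-trans le (FromCover.chosenCentre-centres D⊆B cover))

-- Minimum covers

xCover? : ∀ B cs → Dec (XCover B cs)
xCover? B cs = map′ (λ covered b b∈B → All.lookup covered b∈B) (λ cover → All.tabulate (cover _))
                    (All.all? (λ b → any? (λ c → b ∈? xPentomino c) cs) B)

module _ {B : List Cell} (regular : Regular B) where

  centred-cover : ∀ {cs} → XCover B cs → ∃[ ds ] (ds ⊆ B × XCover B ds × length ds ≤ length cs)
  centred-cover {cs} cover = ds , proj₂ ∘ ∈-filter⁻ (_∈? B) {xs = map absorber cs} , ds-cover ,
                             ≤-trans (length-filter (_∈? B) (map absorber cs)) (≤-reflexive (length-map absorber cs))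
    where
    absorber : Cell → Cell
    absorber c = proj₁ (regular⇒absorbed regular c)
    ds = filter (_∈? B) (map absorber cs)
    ds-cover : XCover B ds
    ds-cover b b∈B with find (cover b b∈B)
    ... | c , c∈cs , b∈Xc with proj₂ (regular⇒absorbed regular c) b b∈B b∈Xc
    ...   | d∈B , b∈Xd = lose (∈-filter⁺ (_∈? B) (∈-map⁺ absorber c∈cs) d∈B) b∈Xd

  -- Covers centred in B can be enumerated, and by centred-cover they are as small as any.
  minimum-cover : ∃[ m ] ((∃[ ds ] (ds ⊆ B × XCover B ds × length ds ≡ m)) ×
                          (∀ cs → XCover B cs → m ≤ length cs))
  minimum-cover with least-witness (λ k → any? (xCover? B) (tuples k B)) {length B}
                                   (lose (∈-tuples⁺ B id) λ b b∈B → lose b∈B (here refl))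
  ... | m , size-m , minimal with find size-m
  ...   | ds , ds∈ , ds-cover with ∈-tuples⁻ m ds∈
  ...     | ds⊆B , ds-length = m , (ds , ds⊆B , ds-cover , ds-length) , at-least
    where
    at-least : ∀ cs → XCover B cs → m ≤ length cs
    at-least cs cover with centred-cover cover
    ... | ds′ , ds′⊆B , ds′-cover , shorter =
      ≤-trans (minimal (lose (∈-tuples⁺ ds′ ds′⊆B) ds′-cover)) shorter

x≡f : ∀ {B m ds fs} → XCover B ds → length ds ≡ m → (∀ cs → XCover B cs → m ≤ length cs) →
      FragmentTiling B fs → length fs ≤ length ds → XNumber B m × FNumber B m
x≡f {B} {m} {ds} {fs} ds-cover ds-length minimal tiling fs≤ds =
  ((ds , ds-cover , ds-length) , minimal) , ((fs , tiling , fs-length) , at-least)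
  where
  at-least : ∀ fs′ → FragmentTiling B fs′ → m ≤ length fs′
  at-least fs′ tiling′ = ≤-trans (minimal _ (tiling⇒cover tiling′)) (≤-reflexive (length-map Fragment.centre fs′))
  fs-length : length fs ≡ m
  fs-length = ≤-antisym (≤-trans fs≤ds (≤-reflexive ds-length)) (at-least fs tiling)

mainTheorem6 : ∀ (B : List Cell) → IsBoard B → Regular B →
    ∃[ n ] (XNumber B n × FNumber B n)
mainTheorem6 B (B-unique , board) regular
  with m , (ds , ds⊆B , ds-cover , ds-length) , minimal ← minimum-cover regular
  with fs , tiling , fs≤ds ← Assignments.tiling-from-cover B B-unique board ds⊆B ds-cover
  = m , x≡f ds-cover ds-length minimal tiling fs≤ds
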